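{- Let $M \ge 2$, $N \ge 1$, $p \ge 0$ be integers such that $\operatorname{rad}(M) \nmid \operatorname{rad}(N)$, and let $\xi$ be a primitive $M$-th root of unity. Define the polynomial $G_p(z) := \sum_{m=0}^{M^{p+1}-1} \xi^{\mathcal{B}_{M,N}(m)} z^m$. Then $z=1$ is a root of $G_p(z)$ of multiplicity at least $p+1$, i.e. $G_p^{(j)}(1) = 0$ for all integers $0 \le j \le p$.
   Context: For integers $M\ge 2$, $N \ge 1$ and $n\ge 0$ with base-$M$ expansion $n=\sum_{i\ge 0} d_i(n) M^i$, $d_i(n)\in\{0,\dots,M-1\}$, the base-shifting map is $\mathcal{B}_{M,N}(n) := \sum_{i\ge 0} d_i(n) N^i$. $\operatorname{rad}(k)$ is the product of the distinct prime factors of $k$. -}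

module Defs where

open import Level using (Level)
open import Data.Nat using (ℕ; zero; suc; NonZero)
import Data.Nat as Nat
open import Data.Nat.ListAction using (product)
open import Data.Nat.Divisibility using (_∣?_)
open import Data.Nat.Primality using (prime?)
open import Data.List using (List; []; _∷_; filter; upTo; map)
open import Data.Product using (_×_)
open import Data.Sum using (_⊎_)
open import Relation.Nullary using (¬_)
open import Relation.Nullary.Decidable using (_×-dec_)
open import Relation.Binary.PropositionalEquality using (_≡_)
open import Algebra.Bundles using (CommutativeRing)
import Algebra.Definitions.RawSemiring as RS

rad : ℕ → ℕ
rad k = product (filter (λ q → prime? q ×-dec q ∣? k) (upTo (suc k)))

-- Base-shifting map B_{M,N}: read the base-M digits of n as base-N digits.
-- The fuel argument (initialised to n) is more than the number of digits.
B-go : (M N : ℕ) → .{{NonZero M}} → ℕ → ℕ → ℕ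
B-go M N zero    n = 0
B-go M N (suc f) n = Nat._+_ (Nat._%_ n M) (Nat._*_ N (B-go M N f (Nat._/_ n M)))

B : (M N : ℕ) → .{{NonZero M}} → ℕ → ℕ
B M N n = B-go M N n n

-- Polynomials over a commutative ring, as coefficient lists c₀ ∷ c₁ ∷ …
module RingDefs {c ℓ : Level} (R : CommutativeRing c ℓ) where
  open CommutativeRing R
  open RS (Algebra.Bundles.Semiring.rawSemiring semiring) using (_^_) renaming (_×_ to _·_)

  IsIntegralDomain : Set (c Level.⊔ ℓ)
  IsIntegralDomain = (¬ (1# ≈ 0#)) × (∀ x y → x * y ≈ 0# → (x ≈ 0#) ⊎ (y ≈ 0#))

  CharZero : Set ℓ
  CharZero = ∀ n → (n · 1#) ≈ 0# → n ≡ 0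

  IsPrimitiveRoot : Carrier → ℕ → Set ℓ
  IsPrimitiveRoot ξ M = (ξ ^ M ≈ 1#) × (∀ k → 1 Nat.≤ k → k Nat.< M → ¬ (ξ ^ k ≈ 1#))

  Poly : Set c
  Poly = List Carrier

  eval : Poly → Carrier → Carrier
  eval []       z = 0#
  eval (a ∷ as) z = a + z * eval as z

  derivAux : ℕ → Poly → Poly
  derivAux k []       = []
  derivAux k (a ∷ as) = (k · a) ∷ derivAux (suc k) as

  deriv : Poly → Poly
  deriv []       = []
  deriv (_ ∷ as) = derivAux 1 as

  derivⁿ : ℕ → Poly → Poly
  derivⁿ zero    P = P
  derivⁿ (suc j) P = deriv (derivⁿ j P)

  G : (M N : ℕ) → .{{NonZero M}} → Carrier → ℕ → Poly
  G M N ξ p = map (λ m → ξ ^ B M N m) (upTo (M Nat.^ suc p))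

-- The j-th derivative of G_p at 1 is Σ_{m < M^(p+1)} ξ^B(m) f(m) with f(m) = m (m-1) ⋯ (m-j+1),
-- a polynomial of degree j ≤ p.  Such twisted sums over m < M^q vanish for every f of degree < q:
-- splitting m = d M^(q-1) + m' by its leading base-M digit gives ξ^B(m) = w^d ξ^B(m') with
-- w = ξ^(N^(q-1)), while f(d M^(q-1) + m') - f(m') has degree < q-1 and so contributes nothing by
-- induction; what is left is (Σ_{d<M} w^d) times the sum over m' < M^(q-1).  Now w^M = 1 and w ≠ 1,
-- since otherwise M ∣ N^(q-1) and every prime of M divides N, i.e. rad M ∣ rad N; so in an integral
-- domain (w - 1) Σ_d w^d = w^M - 1 = 0 forces Σ_d w^d = 0.
module Submission where

open import Defs
open import Level using (Level)
open import Data.Nat as ℕ using (ℕ; suc; _≤_; NonZero)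
open import Data.Nat.Properties using (≤⇒≤′)
open import Data.Nat.Divisibility using (_∤_)
open import Algebra.Bundles using (CommutativeRing)
open import Data.List using (applyUpTo)
open import Data.List.Properties using (map-upTo)
open import Data.Product using (_,_; proj₁)
open import Relation.Nullary using (¬_)
import Relation.Binary.PropositionalEquality as ≡

module BaseShift (M N : ℕ) .{{_ : NonZero M}} (2≤M : 2 ≤ M) where
  open import Data.Nat
  open import Data.Nat.Properties
  open import Data.Nat.DivMod
  open import Data.Nat.Divisibility using (divides)
  open import Data.Nat.Tactic.RingSolver using (solve-∀)
  open import Relation.Binary.PropositionalEquality
  open ≡-Reasoning

  private
    0%M≡0 : 0 % M ≡ 0
    0%M≡0 = m<n⇒m%n≡m (≤-trans (s≤s z≤n) 2≤M)

    0/M≡0 : 0 / M ≡ 0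
    0/M≡0 = 0/n≡0 M

    /M-≤-pred : ∀ {n f} → n ≤ suc f → n / M ≤ f
    /M-≤-pred {zero}  _  rewrite 0/M≡0 = z≤n
    /M-≤-pred {suc n} le = ≤-pred (≤-trans (m/n<m (suc n) M 2≤M) le)

  B-go-zero : ∀ f → B-go M N f 0 ≡ 0
  B-go-zero zero    = refl
  B-go-zero (suc f) rewrite 0%M≡0 | 0/M≡0 | B-go-zero f = *-zeroʳ N

  B-go-fuel : ∀ f g {n} → n ≤ f → n ≤ g → B-go M N f n ≡ B-go M N g n
  B-go-fuel zero    g       z≤n _   = sym (B-go-zero g)
  B-go-fuel (suc f) zero    _   z≤n = B-go-zero (suc f)
  B-go-fuel (suc f) (suc g) {n} n≤f n≤g =
    cong (λ b → n % M + N * b) (B-go-fuel f g (/M-≤-pred n≤f) (/M-≤-pred n≤g))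

  B-step : ∀ n → B M N n ≡ n % M + N * B M N (n / M)
  B-step zero rewrite 0%M≡0 | 0/M≡0 = sym (*-zeroʳ N)
  B-step (suc n) =
    cong (λ b → suc n % M + N * b) (B-go-fuel n (suc n / M) (/M-≤-pred ≤-refl) ≤-refl)

  B-< : ∀ {d} → d < M → B M N d ≡ d
  B-< {d} d<M = begin
    B M N d                    ≡⟨ B-step d ⟩
    d % M + N * B M N (d / M)  ≡⟨ cong₂ (λ r d′ → r + N * B M N d′) (m<n⇒m%n≡m d<M) (m<n⇒m/n≡0 d<M) ⟩
    d + N * 0                  ≡⟨ cong (d +_) (*-zeroʳ N) ⟩
    d + 0                      ≡⟨ +-identityʳ d ⟩
    d                          ∎

  B-digit : ∀ q {d m} → d < M → m < M ^ q → B M N (d * M ^ q + m) ≡ N ^ q * d + B M N m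
  B-digit zero {d} {zero} d<M _ = begin
    B M N (d * 1 + 0)  ≡⟨ cong (B M N) (trans (+-identityʳ _) (*-identityʳ d)) ⟩
    B M N d            ≡⟨ B-< d<M ⟩
    d                  ≡⟨ sym (trans (+-identityʳ _) (*-identityˡ d)) ⟩
    1 * d + 0          ∎
  B-digit zero {m = suc _} _ (s≤s ())
  B-digit (suc q) {d} {m} d<M m<M^[1+q] = begin
    B M N n                                      ≡⟨ B-step n ⟩
    n % M + N * B M N (n / M)                    ≡⟨ cong₂ (λ r n′ → r + N * B M N n′) n%M n/M ⟩
    m % M + N * B M N (d * M ^ q + m / M)        ≡⟨ cong (λ b → m % M + N * b) (B-digit q d<M m/M<M^q) ⟩
    m % M + N * (N ^ q * d + B M N (m / M))      ≡⟨ regroup N (N ^ q) d (m % M) (B M N (m / M)) ⟩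
    N * N ^ q * d + (m % M + N * B M N (m / M))  ≡⟨ cong (N * N ^ q * d +_) (B-step m) ⟨
    N * N ^ q * d + B M N m                      ∎
    where
    n = d * (M * M ^ q) + m
    k = d * M ^ q
    regroup : ∀ N t d r b → r + N * (t * d + b) ≡ N * t * d + (r + N * b)
    regroup = solve-∀
    n≡m+kM : n ≡ m + k * M
    n≡m+kM = reorder d M (M ^ q) m
      where
      reorder : ∀ d M t m → d * (M * t) + m ≡ m + d * t * M
      reorder = solve-∀
    n%M : n % M ≡ m % M
    n%M = trans (cong (_% M) n≡m+kM) ([m+kn]%n≡m%n m k M)
    n/M : n / M ≡ k + m / M
    n/M = begin
      n / M              ≡⟨ cong (_/ M) n≡m+kM ⟩
      (m + k * M) / M    ≡⟨ +-distrib-/-∣ʳ m (divides k refl) ⟩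
      m / M + k * M / M  ≡⟨ cong (m / M +_) (m*n/n≡m k M) ⟩
      m / M + k          ≡⟨ +-comm (m / M) k ⟩
      k + m / M          ∎
    m/M<M^q : m / M < M ^ q
    m/M<M^q = m<n*o⇒m/o<n (subst (m <_) (*-comm M (M ^ q)) m<M^[1+q])

module Radical where
  open import Data.Nat
  open import Data.Nat.Properties
  open import Data.Nat.Divisibility
  open import Data.Nat.Primality
  open import Data.Nat.ListAction using (product)
  open import Data.List using ([]; _∷_; [_]; _++_; filter; upTo)
  open import Data.List.Properties using (upTo-∷ʳ; filter-++; filter-reject; ++-identityʳ)
  open import Data.Product using (_×_; _,_)
  open import Data.Sum using (inj₁; inj₂)
  open import Relation.Nullary using (¬_; yes; no; contradiction)
  open import Relation.Nullary.Decidable using (_×-dec_)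
  open import Relation.Unary using (Pred; Decidable)
  open import Relation.Binary.PropositionalEquality using (_≡_; refl; sym; trans; cong; subst; subst₂; module ≡-Reasoning)
  open import Level using (0ℓ)

  module _ {P : Pred ℕ 0ℓ} (P? : Decidable P) where

    filter-upTo-suc : ∀ {n} → ¬ P n → filter P? (upTo (suc n)) ≡ filter P? (upTo n)
    filter-upTo-suc {n} ¬Pn = begin
      filter P? (upTo (suc n))                ≡⟨ cong (filter P?) (upTo-∷ʳ n) ⟨
      filter P? (upTo n ++ [ n ])             ≡⟨ filter-++ P? (upTo n) [ n ] ⟩
      filter P? (upTo n) ++ filter P? [ n ]   ≡⟨ cong (filter P? (upTo n) ++_) (filter-reject P? ¬Pn) ⟩
      filter P? (upTo n) ++ []                ≡⟨ ++-identityʳ _ ⟩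
      filter P? (upTo n)                      ∎
      where open ≡-Reasoning

    filter-upTo-+ : ∀ {a} → (∀ {x} → P x → x < a) → ∀ k → filter P? (upTo (k + a)) ≡ filter P? (upTo a)
    filter-upTo-+ P<a zero    = refl
    filter-upTo-+ P<a (suc k) =
      trans (filter-upTo-suc (λ P[k+a] → <-irrefl refl (≤-trans (P<a P[k+a]) (m≤n+m _ k))))
            (filter-upTo-+ P<a k)

  product-filter-∣ : ∀ {P Q : Pred ℕ 0ℓ} (P? : Decidable P) (Q? : Decidable Q) → (∀ {x} → P x → Q x) →
                     ∀ xs → product (filter P? xs) ∣ product (filter Q? xs)
  product-filter-∣ P? Q? P⇒Q []       = ∣-refl
  product-filter-∣ P? Q? P⇒Q (x ∷ xs) with P? x | Q? x
  ... | yes _  | yes _  = *-monoʳ-∣ x (product-filter-∣ P? Q? P⇒Q xs)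
  ... | yes Px | no ¬Qx = contradiction (P⇒Q Px) ¬Qx
  ... | no _   | yes _  = ∣-trans (product-filter-∣ P? Q? P⇒Q xs) (n∣m*n x)
  ... | no _   | no _   = product-filter-∣ P? Q? P⇒Q xs

  primeDivisor? : ∀ k → Decidable (λ q → Prime q × q ∣ k)
  primeDivisor? k q = prime? q ×-dec q ∣? k

  rad≡product-upTo : ∀ {m} .{{_ : NonZero m}} a → m < a → rad m ≡ product (filter (primeDivisor? m) (upTo a))
  rad≡product-upTo {m} a m<a = cong product (sym (begin
    filter P? (upTo a)                   ≡⟨ cong (λ b → filter P? (upTo b)) (m∸n+n≡m m<a) ⟨
    filter P? (upTo (a ∸ suc m + suc m)) ≡⟨ filter-upTo-+ P? (λ (_ , q∣m) → s≤s (∣⇒≤ q∣m)) (a ∸ suc m) ⟩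
    filter P? (upTo (suc m))             ∎))
    where
    open ≡-Reasoning
    P? = primeDivisor? m

  rad-∣-rad : ∀ {m n} .{{_ : NonZero m}} .{{_ : NonZero n}} →
              (∀ {p} → Prime p → p ∣ m → p ∣ n) → rad m ∣ rad n
  rad-∣-rad {m} {n} primes⊆ =
    subst₂ _∣_ (sym (rad≡product-upTo a (s≤s (m≤m+n m n)))) (sym (rad≡product-upTo a (s≤s (m≤n+m n m))))
      (product-filter-∣ (primeDivisor? m) (primeDivisor? n) (λ (p , p∣m) → p , primes⊆ p p∣m) (upTo a))
    where a = suc (m + n)

  prime∣^⇒∣ : ∀ {p} m k → Prime p → p ∣ m ^ k → p ∣ m
  prime∣^⇒∣ m zero    pp p∣1 = contradiction (subst Prime (∣1⇒≡1 p∣1) pp) ¬prime[1]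
  prime∣^⇒∣ m (suc k) pp p∣m^[1+k] with euclidsLemma m (m ^ k) pp p∣m^[1+k]
  ... | inj₁ p∣m   = p∣m
  ... | inj₂ p∣m^k = prime∣^⇒∣ m k pp p∣m^k

  ∣^⇒rad∣rad : ∀ {m n} k .{{_ : NonZero m}} .{{_ : NonZero n}} → m ∣ n ^ k → rad m ∣ rad n
  ∣^⇒rad∣rad {n = n} k m∣n^k = rad-∣-rad (λ pp p∣m → prime∣^⇒∣ n k pp (∣-trans p∣m m∣n^k))

module RingFacts {c ℓ : Level} (R : CommutativeRing c ℓ) where
  open CommutativeRing R
  open RingDefs R
  open import Algebra.Bundles using (Semiring)
  open import Algebra.Definitions.RawSemiring (Semiring.rawSemiring semiring) public using (_^_)
  open import Algebra.Definitions.RawSemiring (Semiring.rawSemiring semiring) using () renaming (_×_ to _·_)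
  open import Algebra.Properties.Semiring.Exp semiring using (^-congʳ; ^-homo-*; ^-assocʳ)
  open import Algebra.Properties.Semiring.Mult semiring using (×-comm-*)
  open import Algebra.Properties.Monoid.Mult +-monoid using (×-homo-+; ×-congʳ)
  open import Algebra.Properties.CommutativeSemigroup +-commutativeSemigroup using (interchange)
  open import Algebra.Properties.Group +-group using (∙-cancelʳ; x∙y⁻¹≈ε⇒x≈y; ε⁻¹≈ε)
  open import Algebra.Properties.Ring ring using (-1*x≈-x; [y-z]x≈yx-zx)
  open import Algebra.Properties.AbelianGroup +-abelianGroup using (⁻¹-∙-comm; xyx⁻¹≈y)
  open import Data.Nat using (zero; _≤′_; ≤′-refl; ≤′-step; z<s; s<s)
  import Data.Nat.Properties as ℕ
  open import Algebra.Properties.CommutativeSemigroup ℕ.+-commutativeSemigroup using () renaming (x∙yz≈y∙xz to +-exchange)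
  open import Data.Nat.DivMod using (_%_; _/_; m≡m%n+[m/n]*n; m%n<n)
  open import Data.Nat.Divisibility using (_∣_; m%n≡0⇒n∣m)
  open import Data.List using ([]; _∷_)
  open import Data.Sum using (_⊎_; [_,_])
  open import Function using (id)
  open import Relation.Nullary using (contradiction)
  open ≡ using (_≡_)
  open import Relation.Binary.Reasoning.Setoid setoid
  open import Data.Maybe using (nothing)
  open import Tactic.RingSolver.Core.AlmostCommutativeRing using (fromCommutativeRing)
  -- Over an abstract ring the solver's coefficient arithmetic does not compute (e.g. -1 * 1 is not -1),
  -- so it is used only for identities with unit coefficients and no negation.
  open import Tactic.RingSolver.NonReflective (fromCommutativeRing R (λ _ → nothing))
    using (solve; _⊜_; _⊕_; _⊗_)

  ∑ : ℕ → (ℕ → Carrier) → Carrier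
  ∑ zero    f = 0#
  ∑ (suc n) f = f 0 + ∑ n (λ i → f (suc i))

  syntax ∑ n (λ i → x) = ∑[ i < n ] x

  ∑-cong : ∀ n {f g} → (∀ {i} → i ℕ.< n → f i ≈ g i) → ∑ n f ≈ ∑ n g
  ∑-cong zero    f≈g = refl
  ∑-cong (suc n) f≈g = +-cong (f≈g z<s) (∑-cong n (λ i<n → f≈g (s<s i<n)))

  ∑-distrib-+ : ∀ n f g → ∑[ i < n ] (f i + g i) ≈ ∑ n f + ∑ n g
  ∑-distrib-+ zero    f g = sym (+-identityʳ 0#)
  ∑-distrib-+ (suc n) f g =
    trans (+-congˡ (∑-distrib-+ n (λ i → f (suc i)) (λ i → g (suc i)))) (interchange _ _ _ _)

  *-distribˡ-∑ : ∀ n x f → x * ∑ n f ≈ ∑[ i < n ] (x * f i)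
  *-distribˡ-∑ zero    x f = zeroʳ x
  *-distribˡ-∑ (suc n) x f = trans (distribˡ x _ _) (+-congˡ (*-distribˡ-∑ n x (λ i → f (suc i))))

  ∑-last : ∀ n f → ∑ (suc n) f ≈ ∑ n f + f n
  ∑-last zero    f = +-comm _ _
  ∑-last (suc n) f = trans (+-congˡ (∑-last n (λ i → f (suc i)))) (sym (+-assoc _ _ _))

  ∑-+ : ∀ a b f → ∑ (a ℕ.+ b) f ≈ ∑ a f + ∑[ i < b ] f (a ℕ.+ i)
  ∑-+ zero    b f = sym (+-identityˡ _)
  ∑-+ (suc a) b f = trans (+-congˡ (∑-+ a b (λ i → f (suc i)))) (sym (+-assoc _ _ _))

  ∑-* : ∀ a b f → ∑ (a ℕ.* b) f ≈ ∑[ d < a ] ∑[ m < b ] f (d ℕ.* b ℕ.+ m)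
  ∑-* zero    b f = refl
  ∑-* (suc a) b f = trans (∑-+ b (a ℕ.* b) f) (+-congˡ (trans (∑-* a b (λ i → f (b ℕ.+ i)))
    (∑-cong a (λ _ → ∑-cong b (λ _ → reflexive (≡.cong f (≡.sym (ℕ.+-assoc b _ _))))))))

  geometric : ∀ w n → w * ∑[ i < n ] (w ^ i) + 1# ≈ ∑[ i < n ] (w ^ i) + w ^ n
  geometric w n = begin
    w * ∑[ i < n ] (w ^ i) + 1#   ≈⟨ +-comm _ _ ⟩
    1# + w * ∑[ i < n ] (w ^ i)   ≈⟨ +-congˡ (*-distribˡ-∑ n w (w ^_)) ⟩
    ∑[ i < suc n ] (w ^ i)        ≈⟨ ∑-last n (w ^_) ⟩
    ∑[ i < n ] (w ^ i) + w ^ n    ∎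

  ∑-powers-of-root≈0 : (∀ x y → x * y ≈ 0# → x ≈ 0# ⊎ y ≈ 0#) →
                       ∀ {w n} → w ^ n ≈ 1# → ¬ w ≈ 1# → ∑[ i < n ] (w ^ i) ≈ 0#
  ∑-powers-of-root≈0 noZeroDivisors {w} {n} w^n≈1 w≉1 =
    [ (λ w-1≈0 → contradiction (x∙y⁻¹≈ε⇒x≈y w 1# w-1≈0) w≉1) , id ] (noZeroDivisors _ _ [w-1]S≈0)
    where
    S = ∑[ i < n ] (w ^ i)
    wS≈S : w * S ≈ S
    wS≈S = ∙-cancelʳ 1# _ _ (trans (geometric w n) (+-congˡ w^n≈1))
    [w-1]S≈0 : (w - 1#) * S ≈ 0#
    [w-1]S≈0 = begin
      (w - 1#) * S      ≈⟨ distribʳ S w (- 1#) ⟩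
      w * S + - 1# * S  ≈⟨ +-cong wS≈S (-1*x≈-x S) ⟩
      S - S             ≈⟨ -‿inverseʳ S ⟩
      0#                ∎

  Δ : ℕ → (ℕ → Carrier) → ℕ → Carrier
  Δ a f m = f (a ℕ.+ m) - f m

  -- Deg< q f: f is a polynomial function of degree < q on ℕ, expressed by its q-fold differences vanishing.
  Deg< : ℕ → (ℕ → Carrier) → Set ℓ
  Deg< zero    f = ∀ m → f m ≈ 0#
  Deg< (suc q) f = ∀ a → Deg< q (Δ a f)

  Deg<-cong : ∀ q {f g} → (∀ m → f m ≈ g m) → Deg< q f → Deg< q g
  Deg<-cong zero    f≈g f≈0 m = trans (sym (f≈g m)) (f≈0 m)
  Deg<-cong (suc q) f≈g Δf  a = Deg<-cong q (λ m → +-cong (f≈g _) (-‿cong (f≈g m))) (Δf a)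

  Deg<-suc : ∀ q {f} → Deg< q f → Deg< (suc q) f
  Deg<-suc zero    f≈0 a m = trans (+-cong (f≈0 _) (-‿cong (f≈0 m))) (-‿inverseʳ 0#)
  Deg<-suc (suc q) Δf  a   = Deg<-suc q (Δf a)

  Deg<-≤′ : ∀ {q r f} → q ≤′ r → Deg< q f → Deg< r f
  Deg<-≤′ ≤′-refl         df = df
  Deg<-≤′ (≤′-step {r} q≤r) df = Deg<-suc r (Deg<-≤′ q≤r df)

  Deg<-+ : ∀ q {f g} → Deg< q f → Deg< q g → Deg< q (λ m → f m + g m)
  Deg<-+ zero    f≈0 g≈0 m = trans (+-cong (f≈0 m) (g≈0 m)) (+-identityʳ 0#)
  Deg<-+ (suc q) Δf  Δg  a = Deg<-cong q (λ _ → Δ-+ _ _ _ _) (Deg<-+ q (Δf a) (Δg a))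
    where
    Δ-+ : ∀ x y u v → (x - y) + (u - v) ≈ (x + u) - (y + v)
    Δ-+ x y u v = trans (interchange x (- y) u (- v)) (+-congˡ (⁻¹-∙-comm y v))

  Deg<-*ʳ : ∀ q x {f} → Deg< q f → Deg< q (λ m → f m * x)
  Deg<-*ʳ zero    x f≈0 m = trans (*-congʳ (f≈0 m)) (zeroˡ x)
  Deg<-*ʳ (suc q) x Δf  a = Deg<-cong q (λ _ → [y-z]x≈yx-zx x _ _) (Deg<-*ʳ q x (Δf a))

  Deg<-shift : ∀ q b {f} → Deg< q f → Deg< q (λ m → f (b ℕ.+ m))
  Deg<-shift zero    b     f≈0 m = f≈0 (b ℕ.+ m)
  Deg<-shift (suc q) b {f} Δf  a =
    Deg<-cong q (λ m → +-congʳ (reflexive (≡.cong f (+-exchange a b m)))) (Deg<-shift q b (Δf a))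

  Deg<-*-linear : ∀ q β {f} → Deg< q f → Deg< (suc q) (λ m → f m * (m · 1# + β))
  Deg<-*-linear zero    β f≈0 = Deg<-suc 0 (λ m → trans (*-congʳ (f≈0 m)) (zeroˡ _))
  Deg<-*-linear (suc q) β {f} Δf a = Deg<-cong (suc q) product-rule
    (Deg<-+ (suc q) (Deg<-*-linear q β (Δf a)) (Deg<-*ʳ (suc q) (a · 1#) (Deg<-shift (suc q) a Δf)))
    where
    product-rule : ∀ m → Δ a f m * (m · 1# + β) + f (a ℕ.+ m) * (a · 1#)
                         ≈ Δ a (λ m → f m * (m · 1# + β)) m
    product-rule m = begin
      (f (a ℕ.+ m) - f m) * (m · 1# + β) + f (a ℕ.+ m) * (a · 1#)
        ≈⟨ +-congʳ ([y-z]x≈yx-zx _ _ _) ⟩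
      (f (a ℕ.+ m) * (m · 1# + β) - f m * (m · 1# + β)) + f (a ℕ.+ m) * (a · 1#)
        ≈⟨ solve 5 (λ x z k β n → ((x ⊗ (k ⊕ β) ⊕ z) ⊕ x ⊗ n) ⊜ (x ⊗ ((n ⊕ k) ⊕ β) ⊕ z))
             refl (f (a ℕ.+ m)) (- (f m * (m · 1# + β))) (m · 1#) β (a · 1#) ⟩
      f (a ℕ.+ m) * ((a · 1# + m · 1#) + β) - f m * (m · 1# + β)
        ≈⟨ +-congʳ (*-congˡ (+-congʳ (sym (×-homo-+ 1# a m)))) ⟩
      f (a ℕ.+ m) * ((a ℕ.+ m) · 1# + β) - f m * (m · 1# + β) ∎

  fallingFactorial : ℕ → ℕ → Carrier
  fallingFactorial zero    m = 1#
  fallingFactorial (suc j) m = fallingFactorial j m * (m · 1# - j · 1#)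

  Deg<-fallingFactorial : ∀ j → Deg< (suc j) (fallingFactorial j)
  Deg<-fallingFactorial zero    a m = -‿inverseʳ 1#
  Deg<-fallingFactorial (suc j) = Deg<-*-linear (suc j) (- (j · 1#)) (Deg<-fallingFactorial j)

  fallingFactorial-zero : ∀ j → fallingFactorial (suc j) 0 ≈ 0#
  fallingFactorial-zero zero    = trans (*-identityˡ _) (-‿inverseʳ 0#)
  fallingFactorial-zero (suc j) = trans (*-congʳ (fallingFactorial-zero j)) (zeroˡ _)

  [1+x]-[1+y]≈x-y : ∀ x y → (1# + x) - (1# + y) ≈ x - y
  [1+x]-[1+y]≈x-y x y = begin
    (1# + x) - (1# + y)      ≈⟨ +-congˡ (⁻¹-∙-comm 1# y) ⟨
    (1# + x) + (- 1# - y)    ≈⟨ interchange 1# x (- 1#) (- y) ⟩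
    (1# - 1#) + (x - y)      ≈⟨ +-congʳ (-‿inverseʳ 1#) ⟩
    0# + (x - y)             ≈⟨ +-identityˡ _ ⟩
    x - y                    ∎

  fallingFactorial-suc : ∀ j m → fallingFactorial (suc j) (suc m) ≈ (suc m · 1#) * fallingFactorial j m
  fallingFactorial-suc zero    m =
    trans (*-identityˡ _) (trans (+-congˡ ε⁻¹≈ε) (trans (+-identityʳ _) (sym (*-identityʳ _))))
  fallingFactorial-suc (suc j) m = begin
    fallingFactorial (suc j) (suc m) * ((1# + m · 1#) - (1# + j · 1#))
      ≈⟨ *-congʳ (fallingFactorial-suc j m) ⟩
    ((suc m · 1#) * fallingFactorial j m) * ((1# + m · 1#) - (1# + j · 1#))
      ≈⟨ *-cong refl ([1+x]-[1+y]≈x-y (m · 1#) (j · 1#)) ⟩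
    ((suc m · 1#) * fallingFactorial j m) * (m · 1# - j · 1#)
      ≈⟨ *-assoc _ _ _ ⟩
    (suc m · 1#) * fallingFactorial (suc j) m ∎

  derivAux-applyUpTo : ∀ n k cf d → (∀ m → (k ℕ.+ m) · cf m ≡ d m) → derivAux k (applyUpTo cf n) ≡ applyUpTo d n
  derivAux-applyUpTo zero    k cf d k·cf≡d = ≡.refl
  derivAux-applyUpTo (suc n) k cf d k·cf≡d = ≡.cong₂ _∷_
    (≡.trans (≡.cong (_· cf 0) (≡.sym (ℕ.+-identityʳ k))) (k·cf≡d 0))
    (derivAux-applyUpTo n (suc k) (λ i → cf (suc i)) (λ i → d (suc i))
      (λ m → ≡.trans (≡.cong (_· cf (suc m)) (≡.sym (ℕ.+-suc k m))) (k·cf≡d (suc m))))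

  derivⁿ-suc : ∀ j P → derivⁿ (suc j) P ≡ derivⁿ j (deriv P)
  derivⁿ-suc zero    P = ≡.refl
  derivⁿ-suc (suc j) P = ≡.cong deriv (derivⁿ-suc j P)

  derivⁿ-[] : ∀ j → derivⁿ j [] ≡ []
  derivⁿ-[] zero    = ≡.refl
  derivⁿ-[] (suc j) = ≡.cong deriv (derivⁿ-[] j)

  eval-applyUpTo-1 : ∀ n cf → eval (applyUpTo cf n) 1# ≈ ∑ n cf
  eval-applyUpTo-1 zero    cf = refl
  eval-applyUpTo-1 (suc n) cf = +-congˡ (trans (*-identityˡ _) (eval-applyUpTo-1 n (λ i → cf (suc i))))

  ·-*-transpose : ∀ k x y → (k · x) * y ≈ x * ((k · 1#) * y)
  ·-*-transpose k x y = begin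
    (k · x) * y          ≈⟨ *-congʳ (×-congʳ k (*-identityʳ x)) ⟨
    (k · (x * 1#)) * y   ≈⟨ *-congʳ (×-comm-* k x 1#) ⟨
    (x * (k · 1#)) * y   ≈⟨ *-assoc _ _ _ ⟩
    x * ((k · 1#) * y)   ∎

  eval-derivⁿ-1 : ∀ j n cf → eval (derivⁿ j (applyUpTo cf n)) 1# ≈ ∑[ m < n ] (cf m * fallingFactorial j m)
  eval-derivⁿ-1 zero    n       cf = trans (eval-applyUpTo-1 n cf) (∑-cong n (λ _ → sym (*-identityʳ _)))
  eval-derivⁿ-1 (suc j) zero    cf = reflexive (≡.cong (λ P → eval P 1#) (derivⁿ-[] (suc j)))
  eval-derivⁿ-1 (suc j) (suc n) cf = begin
    eval (derivⁿ (suc j) (applyUpTo cf (suc n))) 1#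
      ≡⟨ ≡.cong (λ P → eval P 1#) (derivⁿ-suc j (applyUpTo cf (suc n))) ⟩
    eval (derivⁿ j (derivAux 1 (applyUpTo (λ m → cf (suc m)) n))) 1#
      ≡⟨ ≡.cong (λ P → eval (derivⁿ j P) 1#) (derivAux-applyUpTo n 1 (λ m → cf (suc m)) cf′ (λ _ → ≡.refl)) ⟩
    eval (derivⁿ j (applyUpTo cf′ n)) 1#
      ≈⟨ eval-derivⁿ-1 j n cf′ ⟩
    ∑[ m < n ] (cf′ m * fallingFactorial j m)
      ≈⟨ ∑-cong n (λ {m} _ → trans (·-*-transpose (suc m) _ _) (*-congˡ (sym (fallingFactorial-suc j m)))) ⟩
    ∑[ m < n ] (cf (suc m) * fallingFactorial (suc j) (suc m))
      ≈⟨ +-identityˡ _ ⟨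
    0# + ∑[ m < n ] (cf (suc m) * fallingFactorial (suc j) (suc m))
      ≈⟨ +-congʳ (trans (*-congˡ (fallingFactorial-zero j)) (zeroʳ _)) ⟨
    ∑[ m < suc n ] (cf m * fallingFactorial (suc j) m) ∎
    where
    cf′ : ℕ → Carrier
    cf′ m = suc m · cf (suc m)

  ^-multiple≈1 : ∀ {x n} → x ^ n ≈ 1# → ∀ t → x ^ (t ℕ.* n) ≈ 1#
  ^-multiple≈1         x^n≈1 zero    = refl
  ^-multiple≈1 {x} {n} x^n≈1 (suc t) =
    trans (^-homo-* x n (t ℕ.* n)) (trans (*-cong x^n≈1 (^-multiple≈1 x^n≈1 t)) (*-identityˡ 1#))

  primitiveRoot-^≈1⇒∣ : ∀ {ξ M k} .{{_ : NonZero M}} → IsPrimitiveRoot ξ M → ξ ^ k ≈ 1# → M ∣ k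
  primitiveRoot-^≈1⇒∣ {ξ} {M} {k} (ξ^M≈1 , minimal) ξ^k≈1 = remainder-zero (k % M) ≡.refl
    where
    ξ^[k%M]≈1 : ξ ^ (k % M) ≈ 1#
    ξ^[k%M]≈1 = begin
      ξ ^ (k % M)                        ≈⟨ *-identityʳ _ ⟨
      ξ ^ (k % M) * 1#                   ≈⟨ *-congˡ (^-multiple≈1 ξ^M≈1 (k / M)) ⟨
      ξ ^ (k % M) * ξ ^ (k / M ℕ.* M)    ≈⟨ ^-homo-* ξ (k % M) (k / M ℕ.* M) ⟨
      ξ ^ (k % M ℕ.+ k / M ℕ.* M)        ≈⟨ ^-congʳ ξ (m≡m%n+[m/n]*n k M) ⟨
      ξ ^ k                              ≈⟨ ξ^k≈1 ⟩
      1#                                 ∎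
    remainder-zero : ∀ r → k % M ≡ r → M ∣ k
    remainder-zero zero    k%M≡0   = m%n≡0⇒n∣m k M k%M≡0
    remainder-zero (suc r) k%M≡1+r =
      contradiction ξ^[k%M]≈1 (minimal (k % M) (≡.subst (1 ℕ.≤_) (≡.sym k%M≡1+r) (ℕ.s≤s ℕ.z≤n)) (m%n<n k M))

  module TwistedSum (noZeroDivisors : ∀ x y → x * y ≈ 0# → x ≈ 0# ⊎ y ≈ 0#)
                    (M N : ℕ) .{{_ : NonZero M}} (2≤M : 2 ℕ.≤ M) {ξ : Carrier}
                    (ξ^M≈1 : ξ ^ M ≈ 1#) (ξ^N^q≉1 : ∀ q → ¬ ξ ^ (N ℕ.^ q) ≈ 1#) where
    open BaseShift M N 2≤M using (B-digit)

    ∑-powers-ξ^N^q≈0 : ∀ q → ∑[ d < M ] ((ξ ^ (N ℕ.^ q)) ^ d) ≈ 0#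
    ∑-powers-ξ^N^q≈0 q = ∑-powers-of-root≈0 noZeroDivisors {n = M}
      (trans (^-assocʳ ξ (N ℕ.^ q) M) (^-multiple≈1 ξ^M≈1 (N ℕ.^ q))) (ξ^N^q≉1 q)

    ∑ξ^B*poly≈0 : ∀ q {f} → Deg< q f → ∑[ m < M ℕ.^ q ] (ξ ^ B M N m * f m) ≈ 0#
    ∑ξ^B*poly≈0 zero    f≈0 = trans (+-identityʳ _) (trans (*-congˡ (f≈0 0)) (zeroʳ _))
    ∑ξ^B*poly≈0 (suc q) {f} Δf = begin
      ∑[ m < M ℕ.* T ] h m                       ≈⟨ ∑-* M T h ⟩
      ∑[ d < M ] ∑[ m < T ] h (d ℕ.* T ℕ.+ m)    ≈⟨ ∑-cong M block ⟩
      ∑[ d < M ] (S * w ^ d)                     ≈⟨ *-distribˡ-∑ M S (w ^_) ⟨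
      S * ∑[ d < M ] (w ^ d)                     ≈⟨ *-congˡ (∑-powers-ξ^N^q≈0 q) ⟩
      S * 0#                                     ≈⟨ zeroʳ S ⟩
      0#                                         ∎
      where
      T = M ℕ.^ q
      w = ξ ^ (N ℕ.^ q)
      h : ℕ → Carrier
      h m = ξ ^ B M N m * f m
      S = ∑[ m < T ] h m

      digit-split : ∀ {d m} → d ℕ.< M → m ℕ.< T →
                    h (d ℕ.* T ℕ.+ m) ≈ w ^ d * h m + w ^ d * (ξ ^ B M N m * Δ (d ℕ.* T) f m)
      digit-split {d} {m} d<M m<T = begin
        ξ ^ B M N (d ℕ.* T ℕ.+ m) * f (d ℕ.* T ℕ.+ m)
          ≈⟨ *-congʳ (^-congʳ ξ (B-digit q d<M m<T)) ⟩
        ξ ^ (N ℕ.^ q ℕ.* d ℕ.+ B M N m) * f (d ℕ.* T ℕ.+ m)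
          ≈⟨ *-congʳ (trans (^-homo-* ξ (N ℕ.^ q ℕ.* d) (B M N m)) (*-congʳ (sym (^-assocʳ ξ (N ℕ.^ q) d)))) ⟩
        (w ^ d * ξ ^ B M N m) * f (d ℕ.* T ℕ.+ m)
          ≈⟨ *-congˡ (trans (sym (+-assoc _ _ _)) (xyx⁻¹≈y (f m) _)) ⟨
        (w ^ d * ξ ^ B M N m) * (f m + Δ (d ℕ.* T) f m)
          ≈⟨ *-assoc _ _ _ ⟩
        w ^ d * (ξ ^ B M N m * (f m + Δ (d ℕ.* T) f m))
          ≈⟨ trans (*-congˡ (distribˡ _ _ _)) (distribˡ _ _ _) ⟩
        w ^ d * h m + w ^ d * (ξ ^ B M N m * Δ (d ℕ.* T) f m) ∎

      block : ∀ {d} → d ℕ.< M → ∑[ m < T ] h (d ℕ.* T ℕ.+ m) ≈ S * w ^ d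
      block {d} d<M = begin
        ∑[ m < T ] h (d ℕ.* T ℕ.+ m)
          ≈⟨ ∑-cong T (digit-split d<M) ⟩
        ∑[ m < T ] (w ^ d * h m + w ^ d * (ξ ^ B M N m * Δ (d ℕ.* T) f m))
          ≈⟨ ∑-distrib-+ T _ _ ⟩
        ∑[ m < T ] (w ^ d * h m) + ∑[ m < T ] (w ^ d * (ξ ^ B M N m * Δ (d ℕ.* T) f m))
          ≈⟨ +-cong (*-distribˡ-∑ T _ h) (*-distribˡ-∑ T _ _) ⟨
        w ^ d * S + w ^ d * ∑[ m < T ] (ξ ^ B M N m * Δ (d ℕ.* T) f m)
          ≈⟨ +-congˡ (trans (*-congˡ (∑ξ^B*poly≈0 q (Δf (d ℕ.* T)))) (zeroʳ _)) ⟩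
        w ^ d * S + 0#
          ≈⟨ trans (+-identityʳ _) (*-comm _ _) ⟩
        S * w ^ d ∎

theorem3p1 : {c ℓ : Level} (R : CommutativeRing c ℓ) →
    let open RingDefs R in
    IsIntegralDomain → CharZero →
    (M N p : ℕ) .{{_ : NonZero M}} → 2 ≤ M → 1 ≤ N → rad M ∤ rad N →
    (ξ : CommutativeRing.Carrier R) → IsPrimitiveRoot ξ M →
    (j : ℕ) → j ≤ p → CommutativeRing._≈_ R (eval (derivⁿ j (G M N ξ p)) (CommutativeRing.1# R)) (CommutativeRing.0# R)
theorem3p1 R (_ , noZeroDivisors) _ M N p 2≤M 1≤N rad∤rad ξ ξ-primitive j j≤p = begin
  eval (derivⁿ j (G M N ξ p)) 1#
    ≡⟨ ≡.cong (λ P → eval (derivⁿ j P) 1#) (map-upTo (λ m → ξ ^ B M N m) (M ℕ.^ suc p)) ⟩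
  eval (derivⁿ j (applyUpTo (λ m → ξ ^ B M N m) (M ℕ.^ suc p))) 1#
    ≈⟨ eval-derivⁿ-1 j (M ℕ.^ suc p) (λ m → ξ ^ B M N m) ⟩
  ∑[ m < M ℕ.^ suc p ] (ξ ^ B M N m * fallingFactorial j m)
    ≈⟨ ∑ξ^B*poly≈0 (suc p) (Deg<-≤′ (≤⇒≤′ (ℕ.s≤s j≤p)) (Deg<-fallingFactorial j)) ⟩
  0# ∎
  where
  open CommutativeRing R
  open RingDefs R
  open RingFacts R
  open Radical using (∣^⇒rad∣rad)
  open import Relation.Binary.Reasoning.Setoid setoid
  ξ^N^q≉1 : ∀ q → ¬ ξ ^ (N ℕ.^ q) ≈ 1#
  ξ^N^q≉1 q ξ^N^q≈1 = rad∤rad (∣^⇒rad∣rad q (primitiveRoot-^≈1⇒∣ ξ-primitive ξ^N^q≈1))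
    where instance _ = ℕ.>-nonZero 1≤N
  open TwistedSum noZeroDivisors M N 2≤M (proj₁ ξ-primitive) ξ^N^q≉1
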